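{- Let $w$ be a pv-string and for a node $u$ of $\mathsf{PDAWG}(w)$ let $\mathsf{SC}_w(u)=\{\mathsf{SL}_w^i(u): i\ge0\}$. If $\mathsf{PDAWG}(w)$ has a primary edge from $u$ to $v$, then the total number of secondary edges from nodes in $\mathsf{SC}_w(u)$ to nodes in $\mathsf{SC}_w(v)$ is at most $|\mathsf{SC}_w(u)|-|\mathsf{SC}_w(v)|+|\Pi|+1$.
   Context: $\Sigma$ (static), $\Pi$ (parameter) disjoint alphabets; $\mathcal{N}$ non-negative integers. $\mathsf{prev}(S)[i]=S[i]$ if $S[i]\in\Sigma$; $=0$ if $S[i]\in\Pi$ does not occur in $S[1:i-1]$; $=i-j$ if $j<i$ is the last earlier position with $S[j]=S[i]\in\Pi$; pv-strings are strings $\mathsf{prev}(S)$ with $S$ over $\Sigma\cup\Pi$. $\mathsf{Z}(a,j)=0$ if $a\in\mathcal{N}$, $a>j$, else $a$; $\langle x\rangle[i]=\mathsf{Z}(x[i],i-1)$. For a pv-string $w$: $\mathsf{PFactor}(w)$ is the set of re-encodings of factors of $w$; $\mathsf{RPos}_w(x)=\{i\in\{0..|w|\}: x=\langle w[i-|x|+1:i]\rangle\}$; $[x]^R_w$ the class of $x$ under equality of $\mathsf{RPos}_w$, $\max u,\min u$ the longest/shortest element of a class $u$. $\mathsf{PDAWG}(w)$: nodes $[x]^R_w$ ($x\in\mathsf{PFactor}(w)$), edges $([x]^R_w,c,[z]^R_w)$ with $z=\max[x]^R_w\cdot c$; suffix links $\mathsf{SL}_w([x]^R_w)=[\langle z[2:|z|]\rangle]^R_w$,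 $z=\min[x]^R_w$, defined on all nodes except the source $[\varepsilon]^R_w$ ($\mathsf{SL}^0_w(u)=u$). An edge $(u,c,v)$ is primary if $\max v=\max u\cdot c$, and secondary otherwise. -}

module Defs where

open import Data.Nat using (ℕ; zero; suc; _∸_; _≤_; _<ᵇ_)
open import Data.Bool using (if_then_else_)
open import Data.Fin using (Fin)
import Data.Fin as Fin
open import Data.Sum using (_⊎_; inj₁; inj₂)
open import Data.Product using (_×_; _,_; ∃; ∃-syntax)
open import Data.List using (List; []; _∷_; _++_; [_]; length; take; drop)
open import Data.List.Membership.Propositional using (_∈_)
open import Data.List.Relation.Unary.Unique.Propositional using (Unique)
open import Relation.Binary.PropositionalEquality using (_≡_; _≢_)
open import Relation.Nullary using (¬_; yes; no)

-- Static alphabet A (the paper's Σ) is an arbitrary type; the parameter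
-- alphabet Π is Fin p, so |Π| = p.  Symbols of pv-strings: static letters
-- (inj₁) or non-negative integers (inj₂).
PV : Set → Set
PV A = A ⊎ ℕ

Str : Set → Set
Str A = List (PV A)

sucIfPos : ℕ → ℕ
sucIfPos zero = zero
sucIfPos (suc k) = suc (suc k)

-- lastOcc b r, r the already-read prefix in reverse order:
-- 0 if b does not occur in r, else (index of first occurrence in r) + 1,
-- i.e. the distance i - j to the last earlier occurrence.
lastOcc : ∀ {A : Set} {p : ℕ} → Fin p → List (A ⊎ Fin p) → ℕ
lastOcc b [] = 0
lastOcc b (inj₁ _ ∷ r) = sucIfPos (lastOcc b r)
lastOcc b (inj₂ b' ∷ r) with b Fin.≟ b'
... | yes _ = 1
... | no _ = sucIfPos (lastOcc b r)

prevGo : ∀ {A : Set} {p : ℕ} → List (A ⊎ Fin p) → List (A ⊎ Fin p) → Str A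
prevGo r [] = []
prevGo r (inj₁ a ∷ s) = inj₁ a ∷ prevGo (inj₁ a ∷ r) s
prevGo r (inj₂ b ∷ s) = inj₂ (lastOcc b r) ∷ prevGo (inj₂ b ∷ r) s

prev : ∀ {A : Set} {p : ℕ} → List (A ⊎ Fin p) → Str A
prev = prevGo []

Z : ∀ {A : Set} → PV A → ℕ → PV A
Z (inj₁ a) j = inj₁ a
Z (inj₂ a) j = if j <ᵇ a then inj₂ 0 else inj₂ a

-- ⟨x⟩ : ⟨x⟩[i] = Z(x[i], i-1)  (1-based i; here j = i-1 is 0-based)
reencFrom : ∀ {A : Set} → ℕ → Str A → Str A
reencFrom j [] = []
reencFrom j (a ∷ x) = Z a j ∷ reencFrom (suc j) x

reenc : ∀ {A : Set} → Str A → Str A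
reenc = reencFrom 0

-- slice w i j = w[i+1 : j]  (1-based, inclusive)
slice : ∀ {A : Set} → Str A → ℕ → ℕ → Str A
slice w i j = take (j ∸ i) (drop i w)

PFactor : ∀ {A : Set} → Str A → Str A → Set
PFactor w x = ∃[ i ] ∃[ j ] (i ≤ j × j ≤ length w × x ≡ reenc (slice w i j))

RPos : ∀ {A : Set} → Str A → Str A → ℕ → Set
RPos w x i = i ≤ length w × length x ≤ i × x ≡ reenc (slice w (i ∸ length x) i)

SameClass : ∀ {A : Set} → Str A → Str A → Str A → Set
SameClass w x y = ∀ i → (RPos w x i → RPos w y i) × (RPos w y i → RPos w x i)

IsMax : ∀ {A : Set} → Str A → Str A → Str A → Set
IsMax w x m = SameClass w x m × (∀ y → SameClass w x y → length y ≤ length m)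

IsMin : ∀ {A : Set} → Str A → Str A → Str A → Set
IsMin w x m = SameClass w x m × (∀ y → SameClass w x y → length m ≤ length y)

-- Nodes of PDAWG(w): each class [x]^R_w (x ∈ PFactor(w)) is represented by
-- its longest element max [x]^R_w.  IsNode w u : u is (the max of) a node.
IsNode : ∀ {A : Set} → Str A → Str A → Set
IsNode w u = PFactor w u × IsMax w u u

-- Edge ([u], c, [z]) with z = max [u] · c = u · c (u a node representative),
-- z ∈ PFactor(w); target node represented by v = max [z]^R_w.
Edge : ∀ {A : Set} → Str A → Str A → PV A → Str A → Set
Edge w u c v = IsNode w u × PFactor w (u ++ [ c ]) × IsMax w (u ++ [ c ]) v

Primary : ∀ {A : Set} → Str A → Str A → PV A → Str A → Set
Primary w u c v = Edge w u c v × v ≡ u ++ [ c ]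

Secondary : ∀ {A : Set} → Str A → Str A → PV A → Str A → Set
Secondary w u c v = Edge w u c v × v ≢ u ++ [ c ]

SL : ∀ {A : Set} → Str A → Str A → Str A → Set
SL w u v = IsNode w u × ¬ SameClass w u [] ×
           ∃[ z ] (IsMin w u z × IsMax w (reenc (drop 1 z)) v)

SLIter : ∀ {A : Set} → Str A → ℕ → Str A → Str A → Set
SLIter w zero u v = IsNode w u × v ≡ u
SLIter w (suc i) u v = ∃[ u' ] (SL w u u' × SLIter w i u' v)

InSC : ∀ {A : Set} → Str A → Str A → Str A → Set
InSC w u v = ∃[ i ] SLIter w i u v

SecEdgeSC : ∀ {A : Set} → Str A → Str A → Str A → Str A × PV A × Str A → Set
SecEdgeSC w u v (u' , c , v') = InSC w u u' × InSC w v v' × Secondary w u' c v'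

-- L is a duplicate-free list of exactly the elements satisfying P
-- (so length L is the cardinality of the finite set P)
Enumerates : ∀ {B : Set} → (B → Set) → List B → Set
Enumerates P L = Unique L × (∀ x → (x ∈ L → P x) × (P x → x ∈ L))

{-# OPTIONS --safe #-}
-- Let u end at position i, so that v = u·c ends at i + 1, as do all nodes of SC(v); hence a node
-- has at most one edge into SC(v).  Charge every secondary edge (u′, c′, v′) to its source u′, and
-- every node v′ = x·d of SC(v) as follows.  The class of x has its longest element u′ in SC(u).
-- If x = u′, the edge u′ → v′ is primary and v′ is charged to u′, which then carries no secondary
-- edge.  If x is shorter, let y be the suffix of u′ of length |x| + 1 (ending at i).  When the first
-- symbol of y is not pointed back to from inside y, charge v′ to the parameter at the start of y:
-- two such windows ending at i cannot start with the same parameter, as it would then recur inside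
-- the longer one.  Otherwise y·d lies in the class of x·d and is longer, contradicting the
-- maximality of v′.  The empty node takes the remaining +1.  Shortest and longest class members are
-- only obtained under double negation, which suffices since the conclusion is decidable.
module Submission where

open import Defs
open import Data.Nat
open import Data.Nat.Properties
open import Data.Nat.Induction using (<-wellFounded)
open import Data.Bool using (true; false; T)
open import Data.Unit using (tt)
open import Data.Empty using (⊥; ⊥-elim)
open import Data.Fin using (Fin)
import Data.Fin as Fin
open import Data.Sum using (_⊎_; inj₁; inj₂)
open import Data.Sum.Properties using (inj₁-injective; inj₂-injective)
open import Data.Product using (_×_; _,_; proj₁; proj₂; ∃-syntax)
open import Data.Maybe using (Maybe; just; nothing)
import Data.Maybe.Properties as Maybe
open import Data.List using (List; []; _∷_; _++_; _∷ʳ_; [_]; length; take; drop; map; allFin; reverse; reverseAcc)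
open import Data.List.Properties using (length-++; length-map; length-drop; length-take; drop-drop; take-[]; ∷ʳ-injectiveˡ; ∷ʳ-injectiveʳ; length-removeAt′; length-tabulate)
open import Data.List.Reverse using (reverseView; []; _∶_∶ʳ_)
open import Data.List.Membership.Propositional using (_∈_; _─_)
open import Data.List.Membership.Propositional.Properties using (∈-map⁺; ∈-map⁻; ∈-++⁺ˡ; ∈-++⁺ʳ; ∈-++⁻; ∈-allFin)
open import Data.List.Relation.Unary.Any using (here; there; index)
import Data.List.Relation.Unary.All as All
open import Data.List.Relation.Unary.AllPairs using (_∷_)
open import Data.List.Relation.Unary.Unique.Propositional using (Unique)
import Data.List.Relation.Unary.Unique.Propositional.Properties as Unique
open import Induction.WellFounded using (Acc; acc)
open import Relation.Binary using (tri<; tri≈; tri>)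
open import Relation.Binary.PropositionalEquality hiding ([_])
open import Relation.Nullary using (¬_; yes; no)
open import Relation.Nullary.Decidable using (decidable-stable; ¬¬-excluded-middle)
open import Relation.Nullary.Negation using (¬¬-Monad)
open import Relation.Nullary.Negation.Core using (DoubleNegation)
open import Effect.Monad using (RawMonad)
open import Level using (0ℓ)
open import Function using (_∘_; id; case_of_)
open import Relation.Unary using (_⊆′_)

open RawMonad (¬¬-Monad {a = 0ℓ})

private
  variable
    X : Set

nth : List X → ℕ → Maybe X
nth []       _       = nothing
nth (x ∷ xs) zero    = just x
nth (x ∷ xs) (suc n) = nth xs n

nth-drop : ∀ a (xs : List X) k → nth (drop a xs) k ≡ nth xs (a + k)
nth-drop zero    xs       k = refl
nth-drop (suc a) []       k = refl
nth-drop (suc a) (x ∷ xs) k = nth-drop a xs k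

nth-take : ∀ ℓ (xs : List X) {k} → k < ℓ → nth (take ℓ xs) k ≡ nth xs k
nth-take (suc ℓ) []       _         = refl
nth-take (suc ℓ) (x ∷ xs) {zero}  _ = refl
nth-take (suc ℓ) (x ∷ xs) {suc k} k<ℓ = nth-take ℓ xs (s≤s⁻¹ k<ℓ)

nth-just : ∀ (xs : List X) {k} → k < length xs → ∃[ x ] nth xs k ≡ just x
nth-just (x ∷ xs) {zero}  _   = x , refl
nth-just (x ∷ xs) {suc k} k<n = nth-just xs (s≤s⁻¹ k<n)

nth-just⇒< : ∀ (xs : List X) {k x} → nth xs k ≡ just x → k < length xs
nth-just⇒< (_ ∷ xs) {zero}  _  = s≤s z≤n
nth-just⇒< (_ ∷ xs) {suc k} eq = s≤s (nth-just⇒< xs eq)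

take-suc : ∀ ℓ (xs : List X) {x} → nth xs ℓ ≡ just x → take (suc ℓ) xs ≡ take ℓ xs ∷ʳ x
take-suc zero    (y ∷ xs) refl = refl
take-suc (suc ℓ) (y ∷ xs) eq   = cong (y ∷_) (take-suc ℓ xs eq)

length-∷ʳ : ∀ (xs : List X) x → length (xs ∷ʳ x) ≡ suc (length xs)
length-∷ʳ xs x = trans (length-++ xs) (+-comm (length xs) 1)

length-take-≤ : ∀ ℓ (xs : List X) → ℓ ≤ length xs → length (take ℓ xs) ≡ ℓ
length-take-≤ ℓ xs ℓ≤n = trans (length-take ℓ xs) (m≤n⇒m⊓n≡m ℓ≤n)

window : List X → ℕ → ℕ → List X
window xs a ℓ = take ℓ (drop a xs)

drop-take : ∀ k ℓ (xs : List X) → drop k (take ℓ xs) ≡ take (ℓ ∸ k) (drop k xs)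
drop-take zero    ℓ       xs       = refl
drop-take (suc k) zero    xs       = refl
drop-take (suc k) (suc ℓ) []       = sym (take-[] (ℓ ∸ k))
drop-take (suc k) (suc ℓ) (x ∷ xs) = drop-take k ℓ xs

drop-window : ∀ (xs : List X) a ℓ k → drop k (window xs a ℓ) ≡ window xs (a + k) (ℓ ∸ k)
drop-window xs a ℓ k = trans (drop-take k ℓ (drop a xs)) (cong (take (ℓ ∸ k)) (drop-drop a k xs))

length-window : ∀ (xs : List X) a ℓ → a + ℓ ≤ length xs → length (window xs a ℓ) ≡ ℓ
length-window xs a ℓ a+ℓ≤n = length-take-≤ ℓ (drop a xs) (begin
  ℓ                  ≡⟨ m+n∸m≡n a ℓ ⟨
  a + ℓ ∸ a          ≤⟨ ∸-monoˡ-≤ a a+ℓ≤n ⟩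
  length xs ∸ a      ≡⟨ length-drop a xs ⟨
  length (drop a xs) ∎)
  where open ≤-Reasoning

nth-window : ∀ (xs : List X) a ℓ {k} → k < ℓ → nth (window xs a ℓ) k ≡ nth xs (a + k)
nth-window xs a ℓ {k} k<ℓ = trans (nth-take ℓ (drop a xs) k<ℓ) (nth-drop a xs k)

window-suc : ∀ (xs : List X) a ℓ {x} → nth xs (a + ℓ) ≡ just x → window xs a (suc ℓ) ≡ window xs a ℓ ∷ʳ x
window-suc xs a ℓ eq = take-suc ℓ (drop a xs) (trans (nth-drop a xs ℓ) eq)

nth-reverseAcc-≥ : ∀ (r xs : List X) {e} → length xs ≤ e → nth (reverseAcc r xs) e ≡ nth r (e ∸ length xs)
nth-reverseAcc-≥ r []       _   = refl
nth-reverseAcc-≥ r (x ∷ xs) {e} n<e =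
  trans (nth-reverseAcc-≥ (x ∷ r) xs (<⇒≤ n<e)) (cong (nth (x ∷ r)) (+-∸-assoc 1 n<e))

nth-reverseAcc-< : ∀ (r xs : List X) {e} → e < length xs → nth (reverseAcc r xs) e ≡ nth xs (length xs ∸ suc e)
nth-reverseAcc-< r (x ∷ xs) {e} e<n with m≤n⇒m<n∨m≡n (s≤s⁻¹ e<n)
... | inj₁ e<n′ = trans (nth-reverseAcc-< (x ∷ r) xs e<n′) (cong (nth (x ∷ xs)) (sym (+-∸-assoc 1 e<n′)))
... | inj₂ refl = trans (nth-reverseAcc-≥ (x ∷ r) xs ≤-refl)
                        (trans (cong (nth (x ∷ r)) (n∸n≡0 e)) (cong (nth (x ∷ xs)) (sym (n∸n≡0 e))))

nth-reverse-take : ∀ (xs : List X) {q e} → q ≤ length xs → e < q → nth (reverse (take q xs)) e ≡ nth xs (q ∸ suc e)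
nth-reverse-take xs {q} {e} q≤n e<q = begin
  nth (reverse (take q xs)) e                 ≡⟨ nth-reverseAcc-< [] (take q xs) (subst (e <_) (sym ℓ≡q) e<q) ⟩
  nth (take q xs) (length (take q xs) ∸ suc e) ≡⟨ cong (λ ℓ → nth (take q xs) (ℓ ∸ suc e)) ℓ≡q ⟩
  nth (take q xs) (q ∸ suc e)                 ≡⟨ nth-take q xs (∸-monoʳ-< (s≤s z≤n) e<q) ⟩
  nth xs (q ∸ suc e)                          ∎
  where
  open ≡-Reasoning
  ℓ≡q = length-take-≤ q xs q≤n

nth-reverse-take-≥ : ∀ (xs : List X) {q e} → q ≤ length xs → q ≤ e → nth (reverse (take q xs)) e ≡ nothing
nth-reverse-take-≥ xs {q} q≤n q≤e = nth-reverseAcc-≥ [] (take q xs) (subst (_≤ _) (sym (length-take-≤ q xs q≤n)) q≤e)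

m∸[1+m∸[1+n]]≡n : ∀ {m n} → n < m → m ∸ suc (m ∸ suc n) ≡ n
m∸[1+m∸[1+n]]≡n {suc m} n<m = m∸[m∸n]≡n (s≤s⁻¹ n<m)

m∸[1+n]<o⇒m∸[1+o]<n : ∀ {m n o} → m ∸ suc n < o → o < m → n < m → m ∸ suc o < n
m∸[1+n]<o⇒m∸[1+o]<n {suc m} {n} {o} m∸n<o o<m n<m =
  subst (m ∸ o <_) (m∸[m∸n]≡n (s≤s⁻¹ n<m)) (∸-monoʳ-< m∸n<o (s≤s⁻¹ o<m))

∈-─ : ∀ {ys : List X} {y z} (y∈ys : y ∈ ys) → z ∈ ys → z ≢ y → z ∈ (ys ─ y∈ys)
∈-─ (here refl)   (here refl)   z≢y = ⊥-elim (z≢y refl)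
∈-─ (here refl)   (there z∈ys)  _   = z∈ys
∈-─ (there y∈ys)  (here refl)   _   = here refl
∈-─ (there y∈ys)  (there z∈ys)  z≢y = there (∈-─ y∈ys z∈ys z≢y)

¬¬-injection⇒length≤ : ∀ {Y : Set} (R : X → Y → Set) (xs : List X) (ys : List Y) → Unique xs →
                       (∀ {x} → x ∈ xs → DoubleNegation (∃[ y ] (y ∈ ys × R x y))) →
                       (∀ {x x′ y} → R x y → R x′ y → x ≡ x′) →
                       DoubleNegation (length xs ≤ length ys)
¬¬-injection⇒length≤ R []       ys _               _     _         = pure z≤n
¬¬-injection⇒length≤ R (x ∷ xs) ys (x∉xs ∷ unique) image injective = do
  (y , y∈ys , Rxy) ← image (here refl)
  xs≤ys─y ← ¬¬-injection⇒length≤ R xs (ys ─ y∈ys) unique (image-without Rxy) injective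
  pure (subst (suc (length xs) ≤_) (sym (length-removeAt′ ys (index y∈ys))) (s≤s xs≤ys─y))
  where
  image-without : ∀ {y y∈ys} → R x y → ∀ {x′} → x′ ∈ xs → DoubleNegation (∃[ y′ ] (y′ ∈ (ys ─ y∈ys) × R x′ y′))
  image-without {y∈ys = y∈ys} Rxy x′∈xs = do
    (y′ , y′∈ys , Rx′y′) ← image (there x′∈xs)
    pure (y′ , ∈-─ y∈ys y′∈ys (λ { refl → All.lookup x∉xs x′∈xs (injective Rxy Rx′y′) }) , Rx′y′)

sums-unique : ∀ {Y : Set} {xs : List X} {ys : List Y} → Unique xs → Unique ys → Unique (map inj₁ xs ++ map inj₂ ys)
sums-unique {xs = xs} {ys} xs-unique ys-unique =
  Unique.++⁺ (Unique.map⁺ inj₁-injective xs-unique) (Unique.map⁺ inj₂-injective ys-unique) disjoint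
  where
  disjoint : ∀ {z} → ¬ (z ∈ map inj₁ xs × z ∈ map inj₂ ys)
  disjoint (z∈xs , z∈ys) with ∈-map⁻ inj₁ z∈xs | ∈-map⁻ inj₂ z∈ys
  ... | _ , _ , refl | _ , _ , ()

¬¬-least : ∀ {P : ℕ → Set} {n} → P n → DoubleNegation (∃[ k ] (P k × ∀ {m} → P m → k ≤ m))
¬¬-least {P} {n} Pn ¬least = none n (<-wellFounded n) Pn
  where
  none : ∀ n → Acc _<_ n → ¬ P n
  none n (acc rs) Pn = ¬least (n , Pn , λ {m} Pm → ≮⇒≥ (λ m<n → none m (rs m<n) Pm))

¬¬-greatest : ∀ {P : ℕ → Set} {n} N → (∀ {m} → P m → m ≤ N) → P n →
              DoubleNegation (∃[ k ] (P k × ∀ {m} → P m → m ≤ k))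
¬¬-greatest {P} {n} N bounded Pn = do
  (k , PN∸k , least) ← ¬¬-least {P = λ k → P (N ∸ k)} {N ∸ n} (P-flip Pn)
  pure (N ∸ k , PN∸k , λ {m} Pm → ∸-monoʳ-≤-flip (least (P-flip Pm)) (bounded Pm))
  where
  P-flip : ∀ {m} → P m → P (N ∸ (N ∸ m))
  P-flip Pm = subst P (sym (m∸[m∸n]≡n (bounded Pm))) Pm
  ∸-monoʳ-≤-flip : ∀ {k m} → k ≤ N ∸ m → m ≤ N → m ≤ N ∸ k
  ∸-monoʳ-≤-flip {k} {m} k≤N∸m m≤N = subst (_≤ N ∸ k) (m∸[m∸n]≡n m≤N) (∸-monoʳ-≤ N k≤N∸m)

module _ {A : Set} where

  Z-< : ∀ {a j} → j < a → Z {A} (inj₂ a) j ≡ inj₂ 0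
  Z-< {a} {j} j<a with j <ᵇ a in eq
  ... | true  = refl
  ... | false = ⊥-elim (subst T eq (<⇒<ᵇ j<a))

  Z-≥ : ∀ {a j} → a ≤ j → Z {A} (inj₂ a) j ≡ inj₂ a
  Z-≥ {a} {j} a≤j with j <ᵇ a in eq
  ... | true  = ⊥-elim (<⇒≱ (<ᵇ⇒< j a (subst T (sym eq) tt)) a≤j)
  ... | false = refl

  Z-Z : ∀ (c : PV A) {j m} → j ≤ m → Z (Z c m) j ≡ Z c j
  Z-Z (inj₁ _) _ = refl
  Z-Z (inj₂ a) {j} {m} j≤m with m <? a
  ... | yes m<a = trans (cong (λ d → Z d j) (Z-< m<a)) (sym (Z-< (≤-<-trans j≤m m<a)))
  ... | no  m≮a = cong (λ d → Z d j) (Z-≥ (≮⇒≥ m≮a))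

  Z-suc : ∀ (c : PV A) {t} → c ≢ inj₂ (suc t) → Z c (suc t) ≡ Z c t
  Z-suc (inj₁ _) _ = refl
  Z-suc (inj₂ a) {t} c≢ with a ≤? t
  ... | yes a≤t = trans (Z-≥ (m≤n⇒m≤1+n a≤t)) (sym (Z-≥ a≤t))
  ... | no  a≰t = trans (Z-< t+1<a) (sym (Z-< (≰⇒> a≰t)))
    where
    t+1<a : suc t < a
    t+1<a = ≤∧≢⇒< (≰⇒> a≰t) (λ t+1≡a → c≢ (cong inj₂ (sym t+1≡a)))

  Z-fixed : ∀ (c : PV A) {k} → 1 ≤ k → Z c k ≡ inj₂ k → c ≡ inj₂ k
  Z-fixed (inj₂ a) {k} 1≤k eq with k <? a
  ... | yes k<a = ⊥-elim (<⇒≢ 1≤k (sym (inj₂-injective (trans (sym eq) (Z-< k<a)))))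
  ... | no  k≮a = trans (sym (Z-≥ (≮⇒≥ k≮a))) eq

  Z-param-0 : ∀ a → Z {A} (inj₂ a) 0 ≡ inj₂ 0
  Z-param-0 zero    = refl
  Z-param-0 (suc a) = refl

  Z≡inj₂⇒param : ∀ (c : PV A) {j n} → Z c j ≡ inj₂ n → ∃[ m ] c ≡ inj₂ m
  Z≡inj₂⇒param (inj₂ m) _ = m , refl

  length-reencFrom : ∀ j (x : Str A) → length (reencFrom j x) ≡ length x
  length-reencFrom j []      = refl
  length-reencFrom j (c ∷ x) = cong suc (length-reencFrom (suc j) x)

  length-reenc : ∀ (x : Str A) → length (reenc x) ≡ length x
  length-reenc = length-reencFrom 0

  reencFrom-++ : ∀ j (x y : Str A) → reencFrom j (x ++ y) ≡ reencFrom j x ++ reencFrom (j + length x) y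
  reencFrom-++ j []      y = cong (λ k → reencFrom k y) (sym (+-identityʳ j))
  reencFrom-++ j (c ∷ x) y = cong (Z c j ∷_) (trans (reencFrom-++ (suc j) x y)
    (cong (λ k → reencFrom (suc j) x ++ reencFrom k y) (sym (+-suc j (length x)))))

  reenc-∷ʳ : ∀ (x : Str A) c → reenc (x ∷ʳ c) ≡ reenc x ∷ʳ Z c (length x)
  reenc-∷ʳ x c = reencFrom-++ 0 x [ c ]

  drop-reencFrom : ∀ k j (x : Str A) → drop k (reencFrom j x) ≡ reencFrom (j + k) (drop k x)
  drop-reencFrom zero    j x       = cong (λ i → reencFrom i x) (sym (+-identityʳ j))
  drop-reencFrom (suc k) j []      = refl
  drop-reencFrom (suc k) j (c ∷ x) =
    trans (drop-reencFrom k (suc j) x) (cong (λ i → reencFrom i (drop k x)) (sym (+-suc j k)))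

  reencFrom-reencFrom : ∀ {j m} (x : Str A) → j ≤ m → reencFrom j (reencFrom m x) ≡ reencFrom j x
  reencFrom-reencFrom []      _   = refl
  reencFrom-reencFrom (c ∷ x) j≤m = cong₂ _∷_ (Z-Z c j≤m) (reencFrom-reencFrom x (s≤s j≤m))

  reenc-drop-reenc : ∀ k (x : Str A) → reenc (drop k (reenc x)) ≡ reenc (drop k x)
  reenc-drop-reenc k x = trans (cong reenc (drop-reencFrom k 0 x)) (reencFrom-reencFrom (drop k x) z≤n)

  length-reenc-drop : ∀ (x : Str A) k → k ≤ length x → length (reenc (drop (length x ∸ k) x)) ≡ k
  length-reenc-drop x k k≤ℓ =
    trans (length-reenc (drop (length x ∸ k) x)) (trans (length-drop (length x ∸ k) x) (m∸[m∸n]≡n k≤ℓ))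

  nth-reencFrom : ∀ j (x : Str A) k {c} → nth x k ≡ just c → nth (reencFrom j x) k ≡ just (Z c (j + k))
  nth-reencFrom j (c ∷ x) zero    refl = cong (λ i → just (Z c i)) (sym (+-identityʳ j))
  nth-reencFrom j (c ∷ x) (suc k) {c′} eq =
    trans (nth-reencFrom (suc j) x k eq) (cong (λ i → just (Z c′ i)) (sym (+-suc j k)))

  nth-reenc-window : ∀ (w : Str A) a ℓ {k c} → k < ℓ → nth w (a + k) ≡ just c →
                     nth (reenc (window w a ℓ)) k ≡ just (Z c k)
  nth-reenc-window w a ℓ {k} k<ℓ eq = nth-reencFrom 0 (window w a ℓ) k (trans (nth-window w a ℓ k<ℓ) eq)

  reenc-window-suc : ∀ (w : Str A) a ℓ {c} → nth w (a + ℓ) ≡ just c →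
                     reenc (window w a (suc ℓ)) ≡ reenc (window w a ℓ) ∷ʳ Z c ℓ
  reenc-window-suc w a ℓ {c} eq = begin
    reenc (window w a (suc ℓ))                        ≡⟨ cong reenc (window-suc w a ℓ eq) ⟩
    reenc (window w a ℓ ∷ʳ c)                         ≡⟨ reenc-∷ʳ (window w a ℓ) c ⟩
    reenc (window w a ℓ) ∷ʳ Z c (length (window w a ℓ)) ≡⟨ cong (λ k → reenc (window w a ℓ) ∷ʳ Z c k) ℓ-length ⟩
    reenc (window w a ℓ) ∷ʳ Z c ℓ                     ∎
    where
    open ≡-Reasoning
    ℓ-length : length (window w a ℓ) ≡ ℓ
    ℓ-length = length-window w a ℓ (<⇒≤ (nth-just⇒< w eq))

module _ {A : Set} (w : Str A) where

  RPos⇒window : ∀ {x i} → RPos w x i → ∃[ a ] (a + length x ≡ i × x ≡ reenc (window w a (length x)))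
  RPos⇒window {x} {i} (_ , ℓ≤i , eq) = i ∸ length x , m∸n+n≡m ℓ≤i ,
    trans eq (cong (λ k → reenc (window w (i ∸ length x) k)) (m∸[m∸n]≡n ℓ≤i))

  window⇒RPos : ∀ {x} a → a + length x ≤ length w → x ≡ reenc (window w a (length x)) →
                RPos w x (a + length x)
  window⇒RPos {x} a bound eq = bound , m≤n+m (length x) a , trans eq (cong reenc (sym (slice-window a (length x))))
    where
    slice-window : ∀ a ℓ → slice w (a + ℓ ∸ ℓ) (a + ℓ) ≡ window w a ℓ
    slice-window a ℓ rewrite m+n∸n≡m a ℓ | m+n∸m≡n a ℓ = refl

  RPos⇒≤length : ∀ {x i} → RPos w x i → i ≤ length w
  RPos⇒≤length = proj₁

  RPos⇒length≤ : ∀ {x i} → RPos w x i → length x ≤ i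
  RPos⇒length≤ = proj₁ ∘ proj₂

  RPos-length-injective : ∀ {x y i} → RPos w x i → RPos w y i → length x ≡ length y → x ≡ y
  RPos-length-injective {i = i} (_ , _ , x≡) (_ , _ , y≡) ℓ≡ =
    trans x≡ (trans (cong (λ k → reenc (slice w (i ∸ k) i)) ℓ≡) (sym y≡))

  RPos-suffix : ∀ {x i} k → RPos w x i → k ≤ length x → RPos w (reenc (drop k x)) i
  RPos-suffix {x} {i} k r k≤ℓ with RPos⇒window r
  ... | a , a+ℓ≡i , x≡ = subst (RPos w y) end (window⇒RPos (a + k) (subst (_≤ length w) (sym end) (RPos⇒≤length r)) y≡)
    where
    ℓ = length x
    y = reenc (drop k x)
    y-length : length y ≡ ℓ ∸ k
    y-length = trans (length-reenc (drop k x)) (length-drop k x)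
    end : a + k + length y ≡ i
    end = begin
      a + k + length y ≡⟨ cong (a + k +_) y-length ⟩
      a + k + (ℓ ∸ k)  ≡⟨ +-assoc a k (ℓ ∸ k) ⟩
      a + (k + (ℓ ∸ k)) ≡⟨ cong (a +_) (m+[n∸m]≡n k≤ℓ) ⟩
      a + ℓ            ≡⟨ a+ℓ≡i ⟩
      i                ∎
      where open ≡-Reasoning
    y≡ : y ≡ reenc (window w (a + k) (length y))
    y≡ = begin
      reenc (drop k x)                        ≡⟨ cong (reenc ∘ drop k) x≡ ⟩
      reenc (drop k (reenc (window w a ℓ)))   ≡⟨ reenc-drop-reenc k (window w a ℓ) ⟩
      reenc (drop k (window w a ℓ))           ≡⟨ cong reenc (drop-window w a ℓ k) ⟩
      reenc (window w (a + k) (ℓ ∸ k))        ≡⟨ cong (reenc ∘ window w (a + k)) y-length ⟨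
      reenc (window w (a + k) (length y))     ∎
      where open ≡-Reasoning

  RPos⇒suffix : ∀ {x y i} → RPos w x i → RPos w y i → length y ≤ length x →
                y ≡ reenc (drop (length x ∸ length y) x)
  RPos⇒suffix {x} {y} rx ry y≤x = RPos-length-injective ry
    (RPos-suffix (length x ∸ length y) rx (m∸n≤m (length x) (length y)))
    (sym (length-reenc-drop x (length y) y≤x))

  shorter⇒RPos-⊆ : ∀ {x y i} → RPos w x i → RPos w y i → length y ≤ length x → RPos w x ⊆′ RPos w y
  shorter⇒RPos-⊆ {x} {y} rx ry y≤x j rx′ = subst (λ z → RPos w z j) (sym (RPos⇒suffix rx ry y≤x))
    (RPos-suffix (length x ∸ length y) rx′ (m∸n≤m (length x) (length y)))

  RPos-∷ʳ⁻ : ∀ {x d i} → RPos w (x ∷ʳ d) (suc i) →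
             RPos w x i × ∃[ c ] (nth w i ≡ just c × d ≡ Z c (length x))
  RPos-∷ʳ⁻ {x} {d} {i} r with RPos⇒window r
  ... | a , a+ℓ′≡i+1 , x∷ʳd≡ = subst (RPos w x) a+ℓ≡i (window⇒RPos a (<⇒≤ a+ℓ<n) x≡) ,
                               c , subst (λ j → nth w j ≡ just c) a+ℓ≡i c-at ,
                               ∷ʳ-injectiveʳ x (reenc (window w a ℓ)) split
    where
    ℓ = length x
    a+ℓ≡i : a + ℓ ≡ i
    a+ℓ≡i = suc-injective (begin
      suc (a + ℓ)         ≡⟨ +-suc a ℓ ⟨
      a + suc ℓ           ≡⟨ cong (a +_) (length-∷ʳ x d) ⟨
      a + length (x ∷ʳ d) ≡⟨ a+ℓ′≡i+1 ⟩
      suc i               ∎)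
      where open ≡-Reasoning
    a+ℓ<n : a + ℓ < length w
    a+ℓ<n = subst (_≤ length w) (cong suc (sym a+ℓ≡i)) (RPos⇒≤length r)
    c = proj₁ (nth-just w a+ℓ<n)
    c-at = proj₂ (nth-just w a+ℓ<n)
    split : x ∷ʳ d ≡ reenc (window w a ℓ) ∷ʳ Z c ℓ
    split = trans x∷ʳd≡ (trans (cong (reenc ∘ window w a) (length-∷ʳ x d)) (reenc-window-suc w a ℓ c-at))
    x≡ : x ≡ reenc (window w a ℓ)
    x≡ = ∷ʳ-injectiveˡ x (reenc (window w a ℓ)) split

  RPos-∷ʳ⁺ : ∀ {x i c} → RPos w x i → nth w i ≡ just c → RPos w (x ∷ʳ Z c (length x)) (suc i)
  RPos-∷ʳ⁺ {x} {i} {c} r c-at with RPos⇒window r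
  ... | a , a+ℓ≡i , x≡ = subst (RPos w y) end (window⇒RPos a (subst (_≤ length w) (sym end) (nth-just⇒< w c-at)) y≡)
    where
    ℓ = length x
    y = x ∷ʳ Z c ℓ
    end : a + length y ≡ suc i
    end = trans (cong (a +_) (length-∷ʳ x (Z c ℓ))) (trans (+-suc a ℓ) (cong suc a+ℓ≡i))
    y≡ : y ≡ reenc (window w a (length y))
    y≡ = sym (begin
      reenc (window w a (length y))  ≡⟨ cong (reenc ∘ window w a) (length-∷ʳ x (Z c ℓ)) ⟩
      reenc (window w a (suc ℓ))     ≡⟨ reenc-window-suc w a ℓ (subst (λ j → nth w j ≡ just c) (sym a+ℓ≡i) c-at) ⟩
      reenc (window w a ℓ) ∷ʳ Z c ℓ  ≡⟨ cong (_∷ʳ Z c ℓ) x≡ ⟨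
      y                              ∎)
      where open ≡-Reasoning

  RPos-∷ʳ-end : ∀ {x d i} → RPos w (x ∷ʳ d) i → ∃[ j ] i ≡ suc j
  RPos-∷ʳ-end {x} {d} {zero}  r = ⊥-elim (n≮0 (subst (_≤ 0) (length-∷ʳ x d) (RPos⇒length≤ r)))
  RPos-∷ʳ-end {i = suc j} _ = j , refl

  RPos-[] : ∀ {i} → i ≤ length w → RPos w [] i
  RPos-[] {i} i≤n = i≤n , z≤n , cong (λ k → reenc (take k (drop i w))) (sym (n∸n≡0 i))

  PFactor⇒RPos : ∀ {x} → PFactor w x → ∃[ i ] RPos w x i
  PFactor⇒RPos {x} (a , j , a≤j , j≤n , x≡) = j , j≤n , subst (_≤ j) (sym ℓ≡) (m∸n≤m j a) ,
    trans x≡ (cong (λ b → reenc (slice w b j)) (sym (trans (cong (j ∸_) ℓ≡) (m∸[m∸n]≡n a≤j))))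
    where
    ℓ≡ : length x ≡ j ∸ a
    ℓ≡ = trans (cong length x≡) (trans (length-reenc (window w a (j ∸ a)))
      (length-window w a (j ∸ a) (subst (_≤ length w) (sym (m+[n∸m]≡n a≤j)) j≤n)))

  RPos⇒PFactor : ∀ {x i} → RPos w x i → PFactor w x
  RPos⇒PFactor {x} {i} (i≤n , _ , x≡) = i ∸ length x , i , m∸n≤m i (length x) , i≤n , x≡

  nth-RPos : ∀ {x i k c} → RPos w x i → k < length x → nth w (i ∸ length x + k) ≡ just c → nth x k ≡ just (Z c k)
  nth-RPos {x} {i} {k} {c} r k<ℓ w[j] with RPos⇒window r
  ... | a , a+ℓ≡i , x≡ = trans (cong (λ y → nth y k) x≡)
    (nth-reenc-window w a (length x) k<ℓ (subst (λ b → nth w (b + k) ≡ just c) start≡a w[j]))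
    where
    start≡a : i ∸ length x ≡ a
    start≡a = trans (cong (_∸ length x) (sym a+ℓ≡i)) (m+n∸n≡m a (length x))

  RPos-inside : ∀ {x i k} → RPos w x i → k < length x → i ∸ length x + k < length w
  RPos-inside {x} {i} {k} r k<ℓ = <-≤-trans (begin-strict
    i ∸ length x + k      <⟨ +-monoʳ-< (i ∸ length x) k<ℓ ⟩
    i ∸ length x + length x ≡⟨ m∸n+n≡m (RPos⇒length≤ r) ⟩
    i                     ∎) (RPos⇒≤length r)
    where open ≤-Reasoning

  SameClass-refl : ∀ x → SameClass w x x
  SameClass-refl x i = (λ r → r) , (λ r → r)

  SameClass-sym : ∀ {x y} → SameClass w x y → SameClass w y x
  SameClass-sym x∼y i = proj₂ (x∼y i) , proj₁ (x∼y i)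

  SameClass-trans : ∀ {x y z} → SameClass w x y → SameClass w y z → SameClass w x z
  SameClass-trans x∼y y∼z i = proj₁ (y∼z i) ∘ proj₁ (x∼y i) , proj₂ (x∼y i) ∘ proj₂ (y∼z i)

  ¬¬-shortest : ∀ x → DoubleNegation (∃[ z ] IsMin w x z)
  ¬¬-shortest x = do
    (_ , (z , refl , x∼z) , least) ← ¬¬-least {P = LengthInClass} (x , refl , SameClass-refl x)
    pure (z , x∼z , λ y x∼y → least (y , refl , x∼y))
    where
    LengthInClass : ℕ → Set
    LengthInClass k = ∃[ y ] (length y ≡ k × SameClass w x y)

  ¬¬-longest : ∀ {x i} → RPos w x i → DoubleNegation (∃[ m ] IsMax w x m)
  ¬¬-longest {x} {i} r = do
    (_ , (m , refl , x∼m) , greatest) ← ¬¬-greatest {P = LengthInClass} (length w) bounded (x , refl , SameClass-refl x)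
    pure (m , x∼m , λ y x∼y → greatest (y , refl , x∼y))
    where
    LengthInClass : ℕ → Set
    LengthInClass k = ∃[ y ] (length y ≡ k × SameClass w x y)
    bounded : ∀ {k} → LengthInClass k → k ≤ length w
    bounded (y , refl , x∼y) = ≤-trans (RPos⇒length≤ (proj₁ (x∼y i) r)) (RPos⇒≤length r)

  IsMax-unique : ∀ {x m m′ i} → IsMax w x m → IsMax w x m′ → RPos w x i → m ≡ m′
  IsMax-unique {x} {m} {m′} {i} (x∼m , max) (x∼m′ , max′) r =
    RPos-length-injective (proj₁ (x∼m i) r) (proj₁ (x∼m′ i) r) (≤-antisym (max′ m x∼m) (max m′ x∼m′))

  IsMax⇒IsNode : ∀ {x m i} → IsMax w x m → RPos w x i → IsNode w m
  IsMax⇒IsNode {i = i} (x∼m , max) r =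
    RPos⇒PFactor (proj₁ (x∼m i) r) , SameClass-refl _ , λ y m∼y → max y (SameClass-trans x∼m m∼y)

  IsMin-nonempty : ∀ {x z} → IsMin w x z → ¬ SameClass w x [] → 1 ≤ length z
  IsMin-nonempty {z = []}    (x∼[] , _) x≁[] = ⊥-elim (x≁[] x∼[])
  IsMin-nonempty {z = _ ∷ _} _          _    = s≤s z≤n

  IsMin-shortest-outside : ∀ {x z y i} → IsMin w x z → RPos w x i → RPos w x ⊆′ RPos w y →
                           ¬ SameClass w x y → length y < length z
  IsMin-shortest-outside {x} {z} {y} {i} (x∼z , _) r x⊆y x≁y with length z ≤? length y
  ... | no  z≰y = ≰⇒> z≰y
  ... | yes z≤y = ⊥-elim (x≁y λ j → x⊆y j , proj₂ (x∼z j) ∘ y⊆z j)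
    where
    y⊆z : RPos w y ⊆′ RPos w z
    y⊆z = shorter⇒RPos-⊆ (x⊆y i r) (proj₁ (x∼z i) r) z≤y

  length-reenc-tail< : ∀ (z : Str A) → 1 ≤ length z → length (reenc (drop 1 z)) < length z
  length-reenc-tail< (_ ∷ z) _ = s≤s (≤-reflexive (length-reenc z))

  <-length⇒≤-reenc-tail : ∀ {m} (z : Str A) → m < length z → m ≤ length (reenc (drop 1 z))
  <-length⇒≤-reenc-tail (_ ∷ z) y<z = subst (_ ≤_) (sym (length-reenc z)) (s≤s⁻¹ y<z)

  IsNode⇒RPos : ∀ {u} → IsNode w u → ∃[ i ] RPos w u i
  IsNode⇒RPos = PFactor⇒RPos ∘ proj₁

  IsMin-tail-⊇ : ∀ {x z} → IsMin w x z → ¬ SameClass w x [] → RPos w x ⊆′ RPos w (reenc (drop 1 z))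
  IsMin-tail-⊇ min x≁[] i r = RPos-suffix 1 (proj₁ (proj₁ min i) r) (IsMin-nonempty min x≁[])

  ¬¬-SL : ∀ {u} → IsNode w u → ¬ SameClass w u [] → DoubleNegation (∃[ u₁ ] SL w u u₁)
  ¬¬-SL {u} nodeU u≁[] = do
    (z , min) ← ¬¬-shortest u
    let (i , r) = IsNode⇒RPos nodeU
    (u₁ , max) ← ¬¬-longest (IsMin-tail-⊇ min u≁[] i r)
    pure (u₁ , nodeU , u≁[] , z , min , max)

  SL⇒IsNode : ∀ {u u₁} → SL w u u₁ → IsNode w u₁
  SL⇒IsNode (nodeU , u≁[] , z , min , max) =
    let (i , r) = IsNode⇒RPos nodeU in IsMax⇒IsNode max (IsMin-tail-⊇ min u≁[] i r)

  SL-sound : ∀ {u u₁} → SL w u u₁ → RPos w u ⊆′ RPos w u₁ × length u₁ < length u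
  SL-sound {u} {u₁} (nodeU , u≁[] , z , min@(u∼z , shortest) , (y₁∼u₁ , _)) =
    u⊆u₁ , <-≤-trans (IsMin-shortest-outside min r u⊆u₁ u≁u₁) (shortest u (SameClass-refl u))
    where
    i = proj₁ (IsNode⇒RPos nodeU)
    r = proj₂ (IsNode⇒RPos nodeU)
    u⊆u₁ : RPos w u ⊆′ RPos w u₁
    u⊆u₁ j = proj₁ (y₁∼u₁ j) ∘ IsMin-tail-⊇ min u≁[] j
    u≁u₁ : ¬ SameClass w u u₁
    u≁u₁ u∼u₁ = <⇒≱ (length-reenc-tail< z (IsMin-nonempty min u≁[]))
                    (shortest _ (SameClass-trans u∼u₁ (SameClass-sym y₁∼u₁)))

  SL-below : ∀ {u u₁ y} → SL w u u₁ → RPos w u ⊆′ RPos w y → ¬ SameClass w u y →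
             RPos w u₁ ⊆′ RPos w y × length y ≤ length u₁
  SL-below {y = y} (nodeU , u≁[] , z , min , (y₁∼u₁ , longest)) u⊆y u≁y =
    (λ j → y₁⊆y j ∘ proj₂ (y₁∼u₁ j)) , ≤-trans y≤y₁ (longest _ (SameClass-refl _))
    where
    i = proj₁ (IsNode⇒RPos nodeU)
    r = proj₂ (IsNode⇒RPos nodeU)
    y≤y₁ : length y ≤ length (reenc (drop 1 z))
    y≤y₁ = <-length⇒≤-reenc-tail z (IsMin-shortest-outside min r u⊆y u≁y)
    y₁⊆y : RPos w (reenc (drop 1 z)) ⊆′ RPos w y
    y₁⊆y = shorter⇒RPos-⊆ (IsMin-tail-⊇ min u≁[] i r) (u⊆y i r) y≤y₁

  InSC-sound : ∀ {v v′} → InSC w v v′ → RPos w v ⊆′ RPos w v′ × length v′ ≤ length v × IsNode w v′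
  InSC-sound (zero , nodeV , refl) = (λ _ r → r) , ≤-refl , nodeV
  InSC-sound (suc k , v₁ , sl , chain) =
    let (v⊆v₁ , v₁<v) = SL-sound sl
        (v₁⊆v′ , v′≤v₁ , nodeV′) = InSC-sound (k , chain)
    in (λ j → v₁⊆v′ j ∘ v⊆v₁ j) , ≤-trans v′≤v₁ (<⇒≤ v₁<v) , nodeV′

  InSC⇒IsNode : ∀ {v v′} → InSC w v v′ → IsNode w v′
  InSC⇒IsNode = proj₂ ∘ proj₂ ∘ InSC-sound

  ¬¬-InSC-max : ∀ {u y} → IsNode w u → RPos w u ⊆′ RPos w y → length y ≤ length u →
                DoubleNegation (∃[ u′ ] (InSC w u u′ × IsMax w y u′))
  ¬¬-InSC-max {u} {y} nodeU = search (<-wellFounded (length u)) nodeU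
    where
    search : ∀ {u} → Acc _<_ (length u) → IsNode w u → RPos w u ⊆′ RPos w y → length y ≤ length u →
             DoubleNegation (∃[ u′ ] (InSC w u u′ × IsMax w y u′))
    search {u} (acc rs) nodeU u⊆y y≤u = do
      no u≁y ← ¬¬-excluded-middle
        where yes u∼y → pure (u , (0 , nodeU , refl) , SameClass-sym u∼y ,
                               λ y′ y∼y′ → proj₂ (proj₂ nodeU) y′ (SameClass-trans u∼y y∼y′))
      (u₁ , sl) ← ¬¬-SL nodeU λ u∼[] → u≁y λ i → u⊆y i , proj₂ (u∼[] i) ∘ RPos-[] ∘ RPos⇒≤length
      let (u₁⊆y , y≤u₁) = SL-below sl u⊆y u≁y
      (u′ , (k , chain) , max) ← search (rs (proj₂ (SL-sound sl))) (SL⇒IsNode sl) u₁⊆y y≤u₁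
      pure (u′ , (suc k , u₁ , sl , chain) , max)

  Edge-into-SC-unique : ∀ {v x c₁ c₂ v₁ v₂ i} → RPos w v i → InSC w v v₁ → InSC w v v₂ →
                        Edge w x c₁ v₁ → Edge w x c₂ v₂ → c₁ ≡ c₂ × v₁ ≡ v₂
  Edge-into-SC-unique {x = x} {c₁} {c₂} {i = i} r v₁∈ v₂∈ (_ , _ , max₁@(xc₁∼v₁ , _)) (_ , _ , max₂@(xc₂∼v₂ , _))
    with ∷ʳ-injectiveʳ x x (RPos-length-injective r₁ r₂ (trans (length-∷ʳ x c₁) (sym (length-∷ʳ x c₂))))
    where
    r₁ = proj₂ (xc₁∼v₁ i) (proj₁ (InSC-sound v₁∈) i r)
    r₂ = proj₂ (xc₂∼v₂ i) (proj₁ (InSC-sound v₂∈) i r)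
  ... | refl = refl , IsMax-unique max₁ max₂ (proj₂ (xc₁∼v₁ i) (proj₁ (InSC-sound v₁∈) i r))

sucIfPos≡0 : ∀ k → sucIfPos k ≡ 0 → k ≡ 0
sucIfPos≡0 zero _ = refl

sucIfPos≡suc : ∀ k {d} → sucIfPos k ≡ suc d → ∃[ d′ ] (k ≡ suc d′ × d ≡ suc d′)
sucIfPos≡suc (suc k) refl = k , refl , refl

module _ {A : Set} {p : ℕ} where

  lastOcc≡0⇒∉ : ∀ b (r : List (A ⊎ Fin p)) → lastOcc b r ≡ 0 → ∀ e → nth r e ≢ just (inj₂ b)
  lastOcc≡0⇒∉ b (inj₁ a  ∷ r) eq (suc e) = lastOcc≡0⇒∉ b r (sucIfPos≡0 _ eq) e
  lastOcc≡0⇒∉ b (inj₂ b′ ∷ r) eq e with b Fin.≟ b′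
  lastOcc≡0⇒∉ b (inj₂ b′ ∷ r) () e       | yes _
  lastOcc≡0⇒∉ b (inj₂ b′ ∷ r) eq zero    | no b≢b′ = b≢b′ ∘ sym ∘ inj₂-injective ∘ Maybe.just-injective
  lastOcc≡0⇒∉ b (inj₂ b′ ∷ r) eq (suc e) | no _    = lastOcc≡0⇒∉ b r (sucIfPos≡0 _ eq) e

  lastOcc≡suc⇒first : ∀ b (r : List (A ⊎ Fin p)) {d} → lastOcc b r ≡ suc d →
                      nth r d ≡ just (inj₂ b) × (∀ {e} → e < d → nth r e ≢ just (inj₂ b))
  lastOcc≡suc⇒first b (inj₁ a ∷ r) eq with sucIfPos≡suc _ eq
  ... | d , eq′ , refl = proj₁ (lastOcc≡suc⇒first b r eq′) , not-before
    where
    not-before : ∀ {e} → e < suc d → nth (inj₁ a ∷ r) e ≢ just (inj₂ b)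
    not-before {suc e} e<d = proj₂ (lastOcc≡suc⇒first b r eq′) (s≤s⁻¹ e<d)
  lastOcc≡suc⇒first b (inj₂ b′ ∷ r) eq with b Fin.≟ b′
  lastOcc≡suc⇒first b (inj₂ b′ ∷ r) {zero} refl | yes refl = refl , λ ()
  lastOcc≡suc⇒first b (inj₂ b′ ∷ r) eq | no b≢b′ with sucIfPos≡suc _ eq
  ... | d , eq′ , refl = proj₁ (lastOcc≡suc⇒first b r eq′) , not-before
    where
    not-before : ∀ {e} → e < suc d → nth (inj₂ b′ ∷ r) e ≢ just (inj₂ b)
    not-before {zero}  _   = b≢b′ ∘ sym ∘ inj₂-injective ∘ Maybe.just-injective
    not-before {suc e} e<d = proj₂ (lastOcc≡suc⇒first b r eq′) (s≤s⁻¹ e<d)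

  length-prevGo : ∀ (r s : List (A ⊎ Fin p)) → length (prevGo r s) ≡ length s
  length-prevGo r []           = refl
  length-prevGo r (inj₁ a ∷ s) = cong suc (length-prevGo (inj₁ a ∷ r) s)
  length-prevGo r (inj₂ b ∷ s) = cong suc (length-prevGo (inj₂ b ∷ r) s)

  nth-prevGo-static : ∀ (r s : List (A ⊎ Fin p)) q {a} → nth s q ≡ just (inj₁ a) → nth (prevGo r s) q ≡ just (inj₁ a)
  nth-prevGo-static r (inj₁ a ∷ s) zero    refl = refl
  nth-prevGo-static r (inj₁ a ∷ s) (suc q) eq   = nth-prevGo-static (inj₁ a ∷ r) s q eq
  nth-prevGo-static r (inj₂ b ∷ s) (suc q) eq   = nth-prevGo-static (inj₂ b ∷ r) s q eq

  nth-prevGo-param : ∀ (r s : List (A ⊎ Fin p)) q {b} → nth s q ≡ just (inj₂ b) →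
                     nth (prevGo r s) q ≡ just (inj₂ (lastOcc b (reverseAcc r (take q s))))
  nth-prevGo-param r (inj₂ b ∷ s) zero    refl = refl
  nth-prevGo-param r (inj₁ a ∷ s) (suc q) eq   = nth-prevGo-param (inj₁ a ∷ r) s q eq
  nth-prevGo-param r (inj₂ b ∷ s) (suc q) eq   = nth-prevGo-param (inj₂ b ∷ r) s q eq

-- The first symbol is a parameter, and no later symbol points back to it (k at position k would).
Fresh : ∀ {A : Set} → Str A → Set
Fresh y = nth y 0 ≡ just (inj₂ 0) × (∀ m → nth y (suc m) ≢ just (inj₂ (suc m)))

module _ {A : Set} {p : ℕ} (S : List (A ⊎ Fin p)) where

  private
    w = prev S

  prev-param⇒param : ∀ {q m} → nth w q ≡ just (inj₂ m) → ∃[ b ] nth S q ≡ just (inj₂ b)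
  prev-param⇒param {q} w[q] with nth-just S (subst (q <_) (length-prevGo [] S) (nth-just⇒< w w[q]))
  ... | inj₁ a , S[q] = ⊥-elim (inj₁≢inj₂ (Maybe.just-injective (trans (sym (nth-prevGo-static [] S q S[q])) w[q])))
    where
    inj₁≢inj₂ : ∀ {a : A} {m : ℕ} → inj₁ a ≢ inj₂ m
    inj₁≢inj₂ ()
  ... | inj₂ b , S[q] = b , S[q]

  private
    lastOcc-at : ∀ {q b m} → nth S q ≡ just (inj₂ b) → nth w q ≡ just (inj₂ m) →
                 lastOcc b (reverse (take q S)) ≡ m
    lastOcc-at {q} S[q] w[q] = inj₂-injective (Maybe.just-injective (trans (sym (nth-prevGo-param [] S q S[q])) w[q]))

    q≤|S| : ∀ {q c} → nth S q ≡ just c → q ≤ length S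
    q≤|S| = <⇒≤ ∘ nth-just⇒< S

  prev-0⇒no-earlier : ∀ {q b} → nth S q ≡ just (inj₂ b) → nth w q ≡ just (inj₂ 0) →
                      ∀ {r} → r < q → nth S r ≢ just (inj₂ b)
  prev-0⇒no-earlier {q} S[q] w[q] {r} r<q S[r] =
    lastOcc≡0⇒∉ _ (reverse (take q S)) (lastOcc-at S[q] w[q]) (q ∸ suc r)
      (trans (nth-reverse-take S (q≤|S| S[q]) (∸-monoʳ-< (s≤s z≤n) r<q)) (trans (cong (nth S) (m∸[1+m∸[1+n]]≡n r<q)) S[r]))

  prev-suc⇒previous : ∀ {q b d} → nth S q ≡ just (inj₂ b) → nth w q ≡ just (inj₂ (suc d)) →
                      d < q × nth S (q ∸ suc d) ≡ just (inj₂ b) ×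
                      (∀ {r} → q ∸ suc d < r → r < q → nth S r ≢ just (inj₂ b))
  prev-suc⇒previous {q} {b} {d} S[q] w[q] = d<q , trans (sym (nth-reverse-take S (q≤|S| S[q]) d<q)) found , not-between
    where
    first = lastOcc≡suc⇒first b (reverse (take q S)) (lastOcc-at S[q] w[q])
    found = proj₁ first
    d<q : d < q
    d<q with d <? q
    ... | yes d<q = d<q
    ... | no  d≮q = ⊥-elim (nothing≢just (trans (sym (nth-reverse-take-≥ S (q≤|S| S[q]) (≮⇒≥ d≮q))) found))
      where
      nothing≢just : ∀ {c : A ⊎ Fin p} → nothing ≢ just c
      nothing≢just ()
    not-between : ∀ {r} → q ∸ suc d < r → r < q → nth S r ≢ just (inj₂ b)
    not-between {r} q∸d<r r<q S[r] = proj₂ first back<d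
      (trans (nth-reverse-take S (q≤|S| S[q]) (∸-monoʳ-< (s≤s z≤n) r<q)) (trans (cong (nth S) (m∸[1+m∸[1+n]]≡n r<q)) S[r]))
      where
      back<d : q ∸ suc r < d
      back<d = m∸[1+n]<o⇒m∸[1+o]<n q∸d<r r<q d<q

  repeat⇒back-pointer : ∀ {s q b} → s < q → nth S s ≡ just (inj₂ b) → nth S q ≡ just (inj₂ b) →
                        ∃[ k ] (1 ≤ k × s + k ≤ q × nth w (s + k) ≡ just (inj₂ k))
  repeat⇒back-pointer {s} {q} = go (<-wellFounded q)
    where
    go : ∀ {q b} → Acc _<_ q → s < q → nth S s ≡ just (inj₂ b) → nth S q ≡ just (inj₂ b) →
         ∃[ k ] (1 ≤ k × s + k ≤ q × nth w (s + k) ≡ just (inj₂ k))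
    go {q} {b} (acc rs) s<q S[s] S[q] with lastOcc b (reverse (take q S)) | nth-prevGo-param [] S q S[q]
    ... | zero  | w[q] = ⊥-elim (prev-0⇒no-earlier S[q] w[q] s<q S[s])
    ... | suc d | w[q] with prev-suc⇒previous S[q] w[q]
    ... | d<q , S[q′] , not-between with <-cmp (q ∸ suc d) s
    ... | tri< q′<s _ _ = ⊥-elim (not-between q′<s s<q S[s])
    ... | tri≈ _ q′≡s _ = suc d , s≤s z≤n , ≤-reflexive s+d≡q , subst (λ i → nth w i ≡ just (inj₂ (suc d))) (sym s+d≡q) w[q]
      where
      s+d≡q : s + suc d ≡ q
      s+d≡q = trans (cong (_+ suc d) (sym q′≡s)) (m∸n+n≡m d<q)
    ... | tri> _ _ s<q′ =
      let (k , 1≤k , s+k≤q′ , w[s+k]) = go (rs (∸-monoʳ-< (s≤s z≤n) d<q)) s<q′ S[s] S[q′]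
      in k , 1≤k , ≤-trans s+k≤q′ (m∸n≤m q (suc d)) , w[s+k]

  Fresh⇒param-start : ∀ {y q} → Fresh y → RPos w y q → ∃[ b ] nth S (q ∸ length y) ≡ just (inj₂ b)
  Fresh⇒param-start {y} {q} (y[0] , _) r with nth-just w (RPos-inside w r (nth-just⇒< y y[0]))
  ... | c , w[start] with Z≡inj₂⇒param c (Maybe.just-injective (trans (sym (nth-RPos w r (nth-just⇒< y y[0]) w[start])) y[0]))
  ... | m , refl = prev-param⇒param (subst (λ i → nth w i ≡ just c) (+-identityʳ (q ∸ length y)) w[start])

  Fresh⇒no-back-pointer : ∀ {y q k} → Fresh y → RPos w y q → 1 ≤ k → k < length y →
                          nth w (q ∸ length y + k) ≢ just (inj₂ k)
  Fresh⇒no-back-pointer {k = suc m} (_ , no-pointer) r _ k<ℓ w[j] =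
    no-pointer m (trans (nth-RPos w r k<ℓ w[j]) (cong just (Z-≥ ≤-refl)))

  back-pointer⇒Fresh : ∀ {y q t} → nth w q ≡ just (inj₂ (suc t)) → RPos w y q → length y ≡ suc t → Fresh y
  back-pointer⇒Fresh {y} {q} {t} w[q] r ℓ≡ with prev-param⇒param w[q]
  ... | b , S[q] = starts-with-param , no-pointer
    where
    previous = prev-suc⇒previous S[q] w[q]
    a = q ∸ length y
    a≡ : q ∸ suc t ≡ a
    a≡ = cong (q ∸_) (sym ℓ≡)
    S[a] : nth S a ≡ just (inj₂ b)
    S[a] = subst (λ i → nth S i ≡ just (inj₂ b)) a≡ (proj₁ (proj₂ previous))
    0<ℓ : 0 < length y
    0<ℓ = subst (0 <_) (sym ℓ≡) (s≤s z≤n)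
    starts-with-param : nth y 0 ≡ just (inj₂ 0)
    starts-with-param = trans (nth-RPos w r 0<ℓ (trans (cong (nth w) (+-identityʳ a)) (nth-prevGo-param [] S a S[a])))
                              (cong just (Z-param-0 _))
    no-pointer : ∀ m → nth y (suc m) ≢ just (inj₂ (suc m))
    no-pointer m y[1+m] with nth-just w (RPos-inside w r (nth-just⇒< y y[1+m]))
    ... | c , w[j] with Z-fixed c (s≤s z≤n) (Maybe.just-injective (trans (sym (nth-RPos w r (nth-just⇒< y y[1+m]) w[j])) y[1+m]))
    ... | refl with prev-param⇒param w[j]
    ... | b′ , S[j] with prev-suc⇒previous S[j] w[j]
    ... | _ , S[j′] , _ = proj₂ (proj₂ previous) a<j j<q (subst (λ b″ → nth S (a + suc m) ≡ just (inj₂ b″)) b′≡b S[j])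
      where
      j<q : a + suc m < q
      j<q = <-≤-trans (+-monoʳ-< a (nth-just⇒< y y[1+m])) (≤-reflexive (m∸n+n≡m (RPos⇒length≤ w r)))
      a<j : q ∸ suc t < a + suc m
      a<j = subst (_< a + suc m) (sym a≡) (m<m+n a (s≤s z≤n))
      b′≡b : b′ ≡ b
      b′≡b = inj₂-injective (Maybe.just-injective (trans (sym (subst (λ i → nth S i ≡ just (inj₂ b′)) (m+n∸n≡m a (suc m)) S[j′])) S[a]))

  Fresh⇒start-not-repeated : ∀ {y q j b} → Fresh y → RPos w y q → q ∸ length y < j → j < q →
                             nth S (q ∸ length y) ≡ just (inj₂ b) → nth S j ≢ just (inj₂ b)
  Fresh⇒start-not-repeated {y} {q} {j} fresh r s<j j<q S[s] S[j] =
    let (k , 1≤k , s+k≤j , w[s+k]) = repeat⇒back-pointer s<j S[s] S[j]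
    in Fresh⇒no-back-pointer fresh r 1≤k (k<ℓ s+k≤j) w[s+k]
    where
    s = q ∸ length y
    k<ℓ : ∀ {k} → s + k ≤ j → k < length y
    k<ℓ {k} s+k≤j = +-cancelˡ-< s k (length y)
      (<-≤-trans (≤-<-trans s+k≤j j<q) (≤-reflexive (sym (m∸n+n≡m (RPos⇒length≤ w r)))))

  ¬Fresh⇒longer-in-class : ∀ {x d u′ i} → RPos w (x ∷ʳ d) (suc i) → SameClass w x u′ → length x < length u′ →
                          ¬ Fresh (reenc (drop (length u′ ∸ suc (length x)) u′)) →
                          ∃[ y ] (SameClass w (x ∷ʳ d) y × length (x ∷ʳ d) < length y)
  ¬Fresh⇒longer-in-class {x} {d} {u′} {i} r x∼u′ x<u′ ¬fresh = y₀ ∷ʳ d , (λ j → forth j , back j) , longer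
    where
    y₀ = reenc (drop (length u′ ∸ suc (length x)) u′)
    y₀-length : length y₀ ≡ suc (length x)
    y₀-length = length-reenc-drop u′ (suc (length x)) x<u′
    x⊆y₀ : RPos w x ⊆′ RPos w y₀
    x⊆y₀ j rx = RPos-suffix w (length u′ ∸ suc (length x)) (proj₁ (x∼u′ j) rx) (m∸n≤m (length u′) (suc (length x)))
    extend : ∀ {j} → RPos w (x ∷ʳ d) (suc j) → RPos w (y₀ ∷ʳ d) (suc j)
    extend {j} r′ with RPos-∷ʳ⁻ w r′
    ... | rx , a , w[j] , d≡ = subst (λ e → RPos w (y₀ ∷ʳ e) (suc j)) Za≡d (RPos-∷ʳ⁺ w (x⊆y₀ j rx) w[j])
      where
      a-no-pointer : a ≢ inj₂ (suc (length x))
      a-no-pointer refl = ¬fresh (back-pointer⇒Fresh w[j] (x⊆y₀ j rx) y₀-length)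
      Za≡d : Z a (length y₀) ≡ d
      Za≡d = trans (cong (Z a) y₀-length) (trans (Z-suc a a-no-pointer) (sym d≡))
    forth : ∀ j → RPos w (x ∷ʳ d) j → RPos w (y₀ ∷ʳ d) j
    forth j r′ with RPos-∷ʳ-end w r′
    ... | _ , refl = extend r′
    tail-length : 1 ≤ length (y₀ ∷ʳ d)
    tail-length = subst (1 ≤_) (sym (length-∷ʳ y₀ d)) (s≤s z≤n)
    tail≡ : reenc (drop 1 (y₀ ∷ʳ d)) ≡ x ∷ʳ d
    tail≡ = RPos-length-injective w (RPos-suffix w 1 (extend r) tail-length) r (begin
      length (reenc (drop 1 (y₀ ∷ʳ d))) ≡⟨ length-reenc (drop 1 (y₀ ∷ʳ d)) ⟩
      length (drop 1 (y₀ ∷ʳ d))         ≡⟨ length-drop 1 (y₀ ∷ʳ d) ⟩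
      length (y₀ ∷ʳ d) ∸ 1              ≡⟨ cong (_∸ 1) (length-∷ʳ y₀ d) ⟩
      length y₀                         ≡⟨ y₀-length ⟩
      suc (length x)                    ≡⟨ length-∷ʳ x d ⟨
      length (x ∷ʳ d)                   ∎)
      where open ≡-Reasoning
    back : ∀ j → RPos w (y₀ ∷ʳ d) j → RPos w (x ∷ʳ d) j
    back j r′ = subst (λ z → RPos w z j) tail≡ (RPos-suffix w 1 r′ tail-length)
    longer : length (x ∷ʳ d) < length (y₀ ∷ʳ d)
    longer = subst₂ _<_ (sym (length-∷ʳ x d)) (sym (trans (length-∷ʳ y₀ d) (cong suc y₀-length))) ≤-refl

module Counting {A : Set} {p : ℕ} (S : List (A ⊎ Fin p)) {u : Str A} {c : PV A} {v : Str A}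
                (u→v : Primary (prev S) u c v) where

  private
    w = prev S
    nodeU = proj₁ (proj₁ u→v)

    end : ∃[ i ] RPos w (u ∷ʳ c) (suc i)
    end with PFactor⇒RPos w (proj₁ (proj₂ (proj₁ u→v)))
    ... | i , r with RPos-∷ʳ-end w r
    ... | i₀ , refl = i₀ , r

  i₀ : ℕ
  i₀ = proj₁ end

  u-at : RPos w u i₀
  u-at = proj₁ (RPos-∷ʳ⁻ w (proj₂ end))

  v-at : RPos w v (suc i₀)
  v-at = subst (λ z → RPos w z (suc i₀)) (sym (proj₂ u→v)) (proj₂ end)

  data Token : Set where
    node   : Str A → Token
    param  : Fin p → Token
    source : Token

  data _↦_ : (Str A × PV A × Str A) ⊎ Str A → Token → Set where
    secondary-edge : ∀ {u′ c′ v′} → SecEdgeSC w u v (u′ , c′ , v′) → inj₁ (u′ , c′ , v′) ↦ node u′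
    primary-edge   : ∀ {x d} → InSC w u x → InSC w v (x ∷ʳ d) → Edge w x d (x ∷ʳ d) → inj₂ (x ∷ʳ d) ↦ node x
    fresh-window   : ∀ {v′ y b} → InSC w v v′ → Fresh y → RPos w y i₀ → length y ≡ length v′ →
                     nth S (i₀ ∸ length y) ≡ just (inj₂ b) → inj₂ v′ ↦ param b
    empty          : inj₂ [] ↦ source

  private
    fresh-collision : ∀ {y y′ b} → Fresh y → RPos w y i₀ → Fresh y′ → RPos w y′ i₀ → length y < length y′ →
                      nth S (i₀ ∸ length y) ≡ just (inj₂ b) → nth S (i₀ ∸ length y′) ≡ just (inj₂ b) → ⊥
    fresh-collision {y} {y′} (y[0] , _) r fresh′ r′ y<y′ S[start] S[start′] =
      Fresh⇒start-not-repeated S fresh′ r′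
        (∸-monoʳ-< y<y′ (RPos⇒length≤ w r′))
        (∸-monoʳ-< (nth-just⇒< y y[0]) (RPos⇒length≤ w r))
        S[start′] S[start]

  ↦-injective : ∀ {a a′ t} → a ↦ t → a′ ↦ t → a ≡ a′
  ↦-injective (secondary-edge (_ , v′∈ , e , _)) (secondary-edge (_ , v″∈ , e′ , _)) =
    let (c′≡c″ , v′≡v″) = Edge-into-SC-unique w v-at v′∈ v″∈ e e′
    in cong inj₁ (cong₂ (λ c″ v″ → _ , c″ , v″) c′≡c″ v′≡v″)
  ↦-injective (secondary-edge (_ , v′∈ , e , not-primary)) (primary-edge _ v″∈ e′) =
    let (c′≡d , v′≡x∷ʳd) = Edge-into-SC-unique w v-at v′∈ v″∈ e e′
    in ⊥-elim (not-primary (trans v′≡x∷ʳd (cong (_ ∷ʳ_) (sym c′≡d))))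
  ↦-injective (primary-edge _ v′∈ e) (secondary-edge (_ , v″∈ , e′ , not-primary)) =
    let (d≡c″ , x∷ʳd≡v″) = Edge-into-SC-unique w v-at v′∈ v″∈ e e′
    in ⊥-elim (not-primary (trans (sym x∷ʳd≡v″) (cong (_ ∷ʳ_) d≡c″)))
  ↦-injective (primary-edge _ v′∈ e) (primary-edge _ v″∈ e′) =
    cong inj₂ (proj₂ (Edge-into-SC-unique w v-at v′∈ v″∈ e e′))
  ↦-injective (fresh-window {y = y} v′∈ fresh r ℓ≡ S[start]) (fresh-window {y = y′} v″∈ fresh′ r′ ℓ≡′ S[start′])
    with <-cmp (length y) (length y′)
  ... | tri< y<y′ _ _ = ⊥-elim (fresh-collision fresh r fresh′ r′ y<y′ S[start] S[start′])
  ... | tri> _ _ y′<y = ⊥-elim (fresh-collision fresh′ r′ fresh r y′<y S[start′] S[start])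
  ... | tri≈ _ y≡y′ _ = cong inj₂ (RPos-length-injective w (proj₁ (InSC-sound w v′∈) (suc i₀) v-at)
                                      (proj₁ (InSC-sound w v″∈) (suc i₀) v-at) (trans (sym ℓ≡) (trans y≡y′ ℓ≡′)))
  ↦-injective empty empty = refl

  private
    module Extension {x d} (v′∈ : InSC w v (x ∷ʳ d)) where
      v′-at : RPos w (x ∷ʳ d) (suc i₀)
      v′-at = proj₁ (InSC-sound w v′∈) (suc i₀) v-at

      x-at : RPos w x i₀
      x-at = proj₁ (RPos-∷ʳ⁻ w v′-at)

      x≤u : length x ≤ length u
      x≤u = s≤s⁻¹ (subst₂ _≤_ (length-∷ʳ x d) (trans (cong length (proj₂ u→v)) (length-∷ʳ u c))
                              (proj₁ (proj₂ (InSC-sound w v′∈))))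

      charge-longest : ∀ {u′} → InSC w u u′ → SameClass w x u′ → length x ≡ length u′ → inj₂ (x ∷ʳ d) ↦ node x
      charge-longest {u′} u′∈ x∼u′ ℓ≡ = primary-edge (subst (InSC w u) (sym x≡u′) u′∈) v′∈
        (subst (IsNode w) (sym x≡u′) (InSC⇒IsNode w u′∈) , RPos⇒PFactor w v′-at , proj₂ (InSC⇒IsNode w v′∈))
        where
        x≡u′ : x ≡ u′
        x≡u′ = RPos-length-injective w x-at (proj₁ (x∼u′ i₀) x-at) ℓ≡

      ¬¬-charge-shorter : ∀ {u′} → SameClass w x u′ → length x < length u′ → DoubleNegation (∃[ t ] inj₂ (x ∷ʳ d) ↦ t)
      ¬¬-charge-shorter {u′} x∼u′ x<u′ = do
        yes fresh ← ¬¬-excluded-middle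
          where no ¬fresh → let (y , x∷ʳd∼y , longer) = ¬Fresh⇒longer-in-class S v′-at x∼u′ x<u′ ¬fresh
                            in ⊥-elim (<⇒≱ longer (proj₂ (proj₂ (InSC⇒IsNode w v′∈)) y x∷ʳd∼y))
        let (b , S[start]) = Fresh⇒param-start S fresh y₀-at
        pure (param b , fresh-window v′∈ fresh y₀-at (trans (length-reenc-drop u′ (suc (length x)) x<u′) (sym (length-∷ʳ x d))) S[start])
        where
        y₀-at : RPos w (reenc (drop (length u′ ∸ suc (length x)) u′)) i₀
        y₀-at = RPos-suffix w _ (proj₁ (x∼u′ i₀) x-at) (m∸n≤m (length u′) (suc (length x)))

  ¬¬-charged : ∀ {v′} → InSC w v v′ → DoubleNegation (∃[ t ] inj₂ v′ ↦ t)
  ¬¬-charged {v′} v′∈ with reverseView v′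
  ... | []         = pure (source , empty)
  ... | x ∶ _ ∶ʳ d = do
    (u′ , u′∈ , x∼u′ , longest) ← ¬¬-InSC-max w nodeU (shorter⇒RPos-⊆ w u-at x-at x≤u) x≤u
    case m≤n⇒m<n∨m≡n (longest x (SameClass-refl w x)) of λ where
      (inj₁ x<u′) → ¬¬-charge-shorter x∼u′ x<u′
      (inj₂ x≡u′) → pure (node x , charge-longest u′∈ x∼u′ x≡u′)
    where open Extension v′∈

  tokens : List (Str A) → List Token
  tokens Lu = map node Lu ++ map param (allFin p) ++ [ source ]

  length-tokens : ∀ Lu → length (tokens Lu) ≡ length Lu + p + 1
  length-tokens Lu = begin
    length (map node Lu ++ map param (allFin p) ++ [ source ])   ≡⟨ length-++ (map node Lu) ⟩
    length (map node Lu) + length (map param (allFin p) ++ [ source ]) ≡⟨ cong₂ _+_ (length-map node Lu)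
                                                                            (length-++ (map param (allFin p))) ⟩
    length Lu + (length (map param (allFin p)) + 1)             ≡⟨ cong (λ n → length Lu + (n + 1))
                                                                    (trans (length-map param (allFin p)) (length-tabulate id)) ⟩
    length Lu + (p + 1)                                         ≡⟨ +-assoc (length Lu) p 1 ⟨
    length Lu + p + 1                                           ∎
    where open ≡-Reasoning

  ¬¬-image : ∀ {Lu Lv Le} → Enumerates (InSC w u) Lu → Enumerates (InSC w v) Lv → Enumerates (SecEdgeSC w u v) Le →
             ∀ {a} → a ∈ map inj₁ Le ++ map inj₂ Lv → DoubleNegation (∃[ t ] (t ∈ tokens Lu × a ↦ t))
  ¬¬-image {Lu} {Lv} {Le} (_ , Lu-complete) (_ , Lv-sound) (_ , Le-sound) a∈ with ∈-++⁻ (map inj₁ Le) a∈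
  ... | inj₁ e∈ with ∈-map⁻ inj₁ e∈
  ...   | (u′ , c′ , v′) , e∈Le , refl =
    let sec = proj₁ (Le-sound _) e∈Le in pure (node u′ , node∈ (proj₁ sec) , secondary-edge sec)
    where
    node∈ : ∀ {u′} → InSC w u u′ → node u′ ∈ tokens Lu
    node∈ u′∈ = ∈-++⁺ˡ (∈-map⁺ node (proj₂ (Lu-complete _) u′∈))
  ¬¬-image {Lu} {Lv} {Le} (_ , Lu-complete) (_ , Lv-sound) _ a∈ | inj₂ v′∈ with ∈-map⁻ inj₂ v′∈
  ...   | v′ , v′∈Lv , refl = do
    (t , a↦t) ← ¬¬-charged (proj₁ (Lv-sound v′) v′∈Lv)
    pure (t , ↦⇒∈ a↦t , a↦t)
    where
    ↦⇒∈ : ∀ {a t} → a ↦ t → t ∈ tokens Lu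
    ↦⇒∈ (secondary-edge (u′∈ , _))  = ∈-++⁺ˡ (∈-map⁺ node (proj₂ (Lu-complete _) u′∈))
    ↦⇒∈ (primary-edge u′∈ _ _)      = ∈-++⁺ˡ (∈-map⁺ node (proj₂ (Lu-complete _) u′∈))
    ↦⇒∈ (fresh-window {b = b} _ _ _ _ _) = ∈-++⁺ʳ (map node Lu) (∈-++⁺ˡ (∈-map⁺ param (∈-allFin b)))
    ↦⇒∈ empty                       = ∈-++⁺ʳ (map node Lu) (∈-++⁺ʳ (map param (allFin p)) (here refl))

lemma8 : {A : Set} (p : ℕ) (S : List (A ⊎ Fin p)) (u v : Str A) (c : PV A) →
    Primary (prev S) u c v →
    (Lu Lv : List (Str A)) (Le : List (Str A × PV A × Str A)) →
    Enumerates (InSC (prev S) u) Lu →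
    Enumerates (InSC (prev S) v) Lv →
    Enumerates (SecEdgeSC (prev S) u v) Le →
    length Le + length Lv ≤ length Lu + p + 1
lemma8 p S u v c u→v Lu Lv Le enU enV enE = decidable-stable (_ ≤? _) do
  bound ← ¬¬-injection⇒length≤ _↦_ (map inj₁ Le ++ map inj₂ Lv) (tokens Lu)
            (sums-unique (proj₁ enE) (proj₁ enV)) (¬¬-image enU enV enE) ↦-injective
  pure (subst₂ _≤_ length-sources (length-tokens Lu) bound)
  where
  open Counting S u→v
  length-sources : length (map inj₁ Le ++ map inj₂ Lv) ≡ length Le + length Lv
  length-sources = trans (length-++ (map inj₁ Le)) (cong₂ _+_ (length-map inj₁ Le) (length-map inj₂ Lv))
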